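{- Let $x,y$ be groves of positive degree. Then: (1) $C(x \dashv y) \geq C(x)C(y)$, with equality if and only if $x$ is a left-inherited grove; (2) $C(x \vdash y) \geq C(x)C(y)$, with equality if and only if $y$ is a right-inherited grove.
   Context: A (planar binary) tree of degree $n$ is a rooted planar binary tree with $n$ trivalent internal vertices and $n+1$ leaves, drawn growing upward from its root, considered up to planar isotopy; $Y_n$ is the set of trees of degree $n$. $\underline{0}$ is the unique tree of degree $0$ (a single edge) and $\underline{1}$ the unique tree of degree $1$. A grove of degree $n$ is a nonempty subset of $Y_n$; a tree is identified with the one-element grove. For trees $x,y$, the graft $x\vee y$ is the tree obtained by attaching the root of $x$ to the left leaf and the root of $y$ to the right leaf of $\underline{1}$; every tree $x$ of positive degree is uniquely $x = x^l \vee x^r$ (left and right parts). For $x\in Y_p$, $y\in Y_q$, $x/y\in Y_{p+q}$ is obtained by identifying the root of $x$ with the leftmost leaf of $y$, and $x\backslash y\in Y_{p+q}$ by identifying the rightmost leaf of $x$ with the root of $y$. $Y_n$ carries the (Tamari) partial order generated by $(a\vee b)\vee c \le a\vee(b\vee c)$ and compatibility with grafting ($a<b$ implies $a\vee c < b\vee c$ and $c\vee a< c\vee b$). The sum of trees is the grove $x+y=\{z : x/y\le z\le x\backslash y\}$; for groves, $x+y=\bigcup_{i,j}(x_i+y_j)$ over member trees. For trees $x,y$ the left sum is $x\dashv y = x^l\vee(x^r+y)$ and the right sum is $x\vdash y=(x+y^l)\vee y^r$ (grafting a tree with a grove means the grove of all such grafts), with the convention $x\vdash\underline{0}=\underline{0}\dashv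 y=\underline{0}$; these are extended to groves by taking unions over member trees. The count $C(x)$ of a grove $x$ is its cardinality. A tree $x$ is left-inherited if $x^r=\underline{0}$ and right-inherited if $x^l=\underline{0}$; a grove is left- (resp. right-) inherited if each of its trees is. -}

module Defs where

open import Data.Nat using (ℕ; zero; suc; _+_; _*_; _≤_)
open import Data.List using (List; []; _∷_; length)
open import Data.List.Relation.Unary.All using (All)
open import Data.List.Relation.Unary.Any using (Any)
open import Data.List.Relation.Unary.Unique.Propositional using (Unique)
open import Data.List.Membership.Propositional using (_∈_)
open import Data.Product using (Σ; ∃; _×_; _,_)
open import Function.Bundles using (_⇔_)
open import Relation.Binary.PropositionalEquality using (_≡_)
open import Relation.Nullary using (¬_)
open import Data.Empty using (⊥)

infixr 6 _∨_

-- Planar binary trees: leaf is the tree 0 (a single edge); a ∨ b is the graft.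
data Tree : Set where
  leaf : Tree
  _∨_  : Tree → Tree → Tree

deg : Tree → ℕ
deg leaf    = 0
deg (a ∨ b) = suc (deg a + deg b)

-- x / y : root of x identified with the leftmost leaf of y
_/ᵗ_ : Tree → Tree → Tree
x /ᵗ leaf    = x
x /ᵗ (a ∨ b) = (x /ᵗ a) ∨ b

-- x \ y : rightmost leaf of x identified with the root of y
_∖ᵗ_ : Tree → Tree → Tree
leaf    ∖ᵗ y = y
(a ∨ b) ∖ᵗ y = a ∨ (b ∖ᵗ y)

data _≤T_ : Tree → Tree → Set where
  rot   : ∀ a b c → ((a ∨ b) ∨ c) ≤T (a ∨ (b ∨ c))
  graftˡ : ∀ {a b} c → a ≤T b → (a ∨ c) ≤T (b ∨ c)
  graftʳ : ∀ {a b} c → a ≤T b → (c ∨ a) ≤T (c ∨ b)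
  ≤T-refl  : ∀ a → a ≤T a
  ≤T-trans : ∀ {a b c} → a ≤T b → b ≤T c → a ≤T c

_∈+_ : Tree → Tree × Tree → Set
z ∈+ (x , y) = ((x /ᵗ y) ≤T z) × (z ≤T (x ∖ᵗ y))

_∈⊣_ : Tree → Tree × Tree → Set
z ∈⊣ (leaf , y)  = z ≡ leaf
z ∈⊣ (l ∨ r , y) = ∃ λ w → (z ≡ l ∨ w) × (w ∈+ (r , y))

_∈⊢_ : Tree → Tree × Tree → Set
z ∈⊢ (x , leaf)  = z ≡ leaf
z ∈⊢ (x , l ∨ r) = ∃ λ w → (z ≡ w ∨ r) × (w ∈+ (x , l))

-- A grove of degree n: a nonempty finite subset of Y_n, given as a
-- duplicate-free nonempty list of trees of degree n.
record Grove (n : ℕ) : Set where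
  field
    trees    : List Tree
    distinct : Unique trees
    nonempty : ¬ (trees ≡ [])
    degrees  : All (λ t → deg t ≡ n) trees
open Grove public

C : ∀ {n} → Grove n → ℕ
C g = length (trees g)

LeftSum : ∀ {p q} → Grove p → Grove q → Tree → Set
LeftSum x y z = Any (λ a → Any (λ b → z ∈⊣ (a , b)) (trees y)) (trees x)

RightSum : ∀ {p q} → Grove p → Grove q → Tree → Set
RightSum x y z = Any (λ a → Any (λ b → z ∈⊢ (a , b)) (trees y)) (trees x)

HasCount : (Tree → Set) → ℕ → Set
HasCount P k = Σ (List Tree) λ l → Unique l × (∀ t → (t ∈ l) ⇔ P t) × (length l ≡ k)

LeftInherited : Tree → Set
LeftInherited leaf    = ⊥
LeftInherited (l ∨ r) = r ≡ leaf

RightInherited : Tree → Set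
RightInherited leaf    = ⊥
RightInherited (l ∨ r) = l ≡ leaf

LeftInheritedGrove : ∀ {n} → Grove n → Set
LeftInheritedGrove g = All LeftInherited (trees g)

RightInheritedGrove : ∀ {n} → Grove n → Set
RightInheritedGrove g = All RightInherited (trees g)

-- Write a = l ∨ r. As r /ᵗ b is the least element of the interval r + b, the map
-- (a , b) ↦ l ∨ (r /ᵗ b) sends x × y into x ⊣ y, injectively because all trees of x
-- have the same degree; hence C (x ⊣ y) ≥ C x · C y. If r = leaf the interval
-- leaf + b is just {b}, so for left-inherited x the map is onto. Otherwise
-- l ∨ (r ∖ᵗ b) ∈ x ⊣ y is not in the image: r ∖ᵗ b keeps the left subtree of r, of
-- degree below deg r, whereas the left subtree of r′ /ᵗ b′ has degree at least deg r′.
-- The right sum follows by reflecting trees, which reverses the Tamari order,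
-- exchanges /ᵗ with ∖ᵗ and turns x ⊢ y into (mirror y) ⊣ (mirror x). Counting
-- requires the Tamari order to be decidable and antisymmetric; both come from a
-- potential that every rotation strictly increases.

module Submission where

open import Defs
open import Data.Nat using (ℕ; zero; suc; _+_; _*_; _≤_; _<_; _≥_; z≤n; s≤s; z<s)
open import Data.Nat.Properties hiding (_≟_)
open import Data.Product using (Σ; ∃; ∃₂; _×_; _,_; proj₁; proj₂; uncurry)
open import Data.Empty using (⊥-elim)
open import Data.Sum using (inj₁; inj₂)
open import Data.List using (List; []; _∷_; length; map; _++_; filter; cartesianProductWith; cartesianProduct)
open import Data.List.Properties using (length-map; length-++; length-removeAt′)
open import Data.List.Relation.Unary.All as All using (All; []; _∷_)
open import Data.List.Relation.Unary.All.Properties as All using ()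
open import Data.List.Relation.Unary.Any as Any using (Any; here; there; any?; _─_)
open import Data.List.Relation.Unary.Any.Properties as Any using ()
open import Data.List.Relation.Unary.AllPairs using ([]; _∷_)
open import Data.List.Relation.Unary.Unique.Propositional using (Unique)
open import Data.List.Relation.Unary.Unique.Propositional.Properties as Unique using ()
open import Data.List.Relation.Binary.Subset.Propositional using (_⊆_)
open import Data.List.Membership.Propositional using (_∈_; find; lose)
open import Data.List.Membership.Propositional.Properties
open import Function using (_∘_; id)
open import Function.Bundles using (_⇔_; mk⇔; Equivalence)
import Function.Properties.Equivalence as ⇔
open import Relation.Binary.PropositionalEquality
open import Relation.Binary.Definitions using (DecidableEquality)
open import Relation.Binary.Construct.Closure.ReflexiveTransitive using (Star; ε; _◅_; _◅◅_; gmap)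
open import Relation.Nullary using (¬_; Dec; yes; no)
open import Relation.Nullary.Decidable using (map′; _×-dec_; _⊎-dec_)
open import Relation.Unary using (Decidable)

open Equivalence using (to; from)

∨-injective : ∀ {a b c d} → a ∨ b ≡ c ∨ d → a ≡ c × b ≡ d
∨-injective refl = refl , refl

_≟_ : DecidableEquality Tree
leaf    ≟ leaf    = yes refl
leaf    ≟ (_ ∨ _) = no λ ()
(_ ∨ _) ≟ leaf    = no λ ()
(a ∨ b) ≟ (c ∨ d) with a ≟ c | b ≟ d
... | yes refl | yes refl = yes refl
... | no a≢c   | _        = no (a≢c ∘ proj₁ ∘ ∨-injective)
... | yes _    | no b≢d   = no (b≢d ∘ proj₂ ∘ ∨-injective)

deg-∨-cancelˡ : ∀ {l r r′} → deg (l ∨ r) ≡ deg (l ∨ r′) → deg r ≡ deg r′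
deg-∨-cancelˡ {l} e = +-cancelˡ-≡ (deg l) _ _ (suc-injective e)

-- Tamari order

data Step : Tree → Tree → Set where
  rotate : ∀ a b c → Step ((a ∨ b) ∨ c) (a ∨ (b ∨ c))
  stepˡ  : ∀ {a b} c → Step a b → Step (a ∨ c) (b ∨ c)
  stepʳ  : ∀ {a b} c → Step a b → Step (c ∨ a) (c ∨ b)

Step⇒≤T : ∀ {a b} → Step a b → a ≤T b
Step⇒≤T (rotate a b c) = rot a b c
Step⇒≤T (stepˡ c s)    = graftˡ c (Step⇒≤T s)
Step⇒≤T (stepʳ c s)    = graftʳ c (Step⇒≤T s)

Star⇒≤T : ∀ {a b} → Star Step a b → a ≤T b
Star⇒≤T {a} ε   = ≤T-refl a
Star⇒≤T (s ◅ p) = ≤T-trans (Step⇒≤T s) (Star⇒≤T p)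

≤T⇒Star : ∀ {a b} → a ≤T b → Star Step a b
≤T⇒Star (rot a b c)    = rotate a b c ◅ ε
≤T⇒Star (graftˡ c p)   = gmap (_∨ c) (stepˡ c) (≤T⇒Star p)
≤T⇒Star (graftʳ c p)   = gmap (c ∨_) (stepʳ c) (≤T⇒Star p)
≤T⇒Star (≤T-refl a)    = ε
≤T⇒Star (≤T-trans p q) = ≤T⇒Star p ◅◅ ≤T⇒Star q

deg-rotate : ∀ a b c → deg ((a ∨ b) ∨ c) ≡ deg (a ∨ (b ∨ c))
deg-rotate a b c = cong suc (trans (cong suc (+-assoc (deg a) (deg b) (deg c)))
                                   (sym (+-suc (deg a) (deg b + deg c))))

≤T-deg : ∀ {a b} → a ≤T b → deg a ≡ deg b
≤T-deg (rot a b c)    = deg-rotate a b c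
≤T-deg (graftˡ c p)   = cong (λ n → suc (n + deg c)) (≤T-deg p)
≤T-deg (graftʳ c p)   = cong (λ n → suc (deg c + n)) (≤T-deg p)
≤T-deg (≤T-refl a)    = refl
≤T-deg (≤T-trans p q) = trans (≤T-deg p) (≤T-deg q)

-- A rotation (a ∨ b) ∨ c ↦ a ∨ (b ∨ c) raises the potential by 1 + deg c.
potential : Tree → ℕ
potential leaf    = 0
potential (l ∨ r) = potential l + potential r + deg r

potential-rotate : ∀ a b c → potential (a ∨ (b ∨ c)) ≡ suc (deg c + potential ((a ∨ b) ∨ c))
potential-rotate a b c = arith (potential a) (potential b) (potential c) (deg b) (deg c)
  where
  open import Data.Nat.Tactic.RingSolver using (solve-∀)
  arith : ∀ pa pb pc db dc → pa + (pb + pc + dc) + suc (db + dc) ≡ suc (dc + (pa + pb + db + pc + dc))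
  arith = solve-∀

Step-potential : ∀ {a b} → Step a b → potential a < potential b
Step-potential (rotate a b c) =
  ≤-trans (s≤s (m≤n+m _ (deg c))) (≤-reflexive (sym (potential-rotate a b c)))
Step-potential (stepˡ c s) = +-monoˡ-< (deg c) (+-monoˡ-< (potential c) (Step-potential s))
Step-potential (stepʳ c s) =
  +-mono-<-≤ (+-monoʳ-< (potential c) (Step-potential s)) (≤-reflexive (≤T-deg (Step⇒≤T s)))

Star-potential : ∀ {a b} → Star Step a b → potential a ≤ potential b
Star-potential ε       = ≤-refl
Star-potential (s ◅ p) = ≤-trans (<⇒≤ (Step-potential s)) (Star-potential p)

≤T-antisym : ∀ {a b} → a ≤T b → b ≤T a → a ≡ b
≤T-antisym a≤b b≤a with ≤T⇒Star a≤b
... | ε     = refl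
... | s ◅ p = ⊥-elim (<⇒≱ (<-≤-trans (Step-potential s) (Star-potential p))
                          (Star-potential (≤T⇒Star b≤a)))

rotationsAt : Tree → Tree → List Tree
rotationsAt leaf    c = []
rotationsAt (a ∨ b) c = a ∨ (b ∨ c) ∷ []

successors : Tree → List Tree
successors leaf    = []
successors (l ∨ r) = rotationsAt l r ++ map (_∨ r) (successors l) ++ map (l ∨_) (successors r)

successors-sound : ∀ a {b} → b ∈ successors a → Step a b
successors-sound (l ∨ r) b∈ with ∈-++⁻ (rotationsAt l r) b∈
successors-sound ((a ∨ b) ∨ c) _ | inj₁ (here refl) = rotate a b c
successors-sound (l ∨ r) _ | inj₂ b∈ with ∈-++⁻ (map (_∨ r) (successors l)) b∈
... | inj₁ b∈ˡ with _ , s∈ , refl ← ∈-map⁻ (_∨ r) b∈ˡ = stepˡ r (successors-sound l s∈)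
... | inj₂ b∈ʳ with _ , s∈ , refl ← ∈-map⁻ (l ∨_) b∈ʳ = stepʳ l (successors-sound r s∈)

successors-complete : ∀ {a b} → Step a b → b ∈ successors a
successors-complete (rotate a b c) = here refl
successors-complete (stepˡ {a} c s) =
  ∈-++⁺ʳ (rotationsAt a c) (∈-++⁺ˡ (∈-map⁺ (_∨ c) (successors-complete s)))
successors-complete (stepʳ {a} c s) =
  ∈-++⁺ʳ (rotationsAt c a) (∈-++⁺ʳ (map (_∨ a) (successors c)) (∈-map⁺ (c ∨_) (successors-complete s)))

-- Every step raises the potential, so the fuel bounds the length of any path from a to b.
mutual
  Star? : ∀ fuel a b → potential b ≤ potential a + fuel → Dec (Star Step a b)
  Star? fuel a b bound with a ≟ b
  ... | yes refl = yes ε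
  Star? zero a b bound | no a≢b = no λ where
    ε       → a≢b refl
    (s ◅ p) → <⇒≱ (<-≤-trans (Step-potential s) (Star-potential p))
                  (≤-trans bound (≤-reflexive (+-identityʳ (potential a))))
  Star? (suc fuel) a b bound | no a≢b =
    map′ viaSuccessor firstStep (Any-Star? fuel b (successors a) (All.tabulate successor-bound))
    where
    successor-bound : ∀ {s} → s ∈ successors a → potential b ≤ potential s + fuel
    successor-bound s∈ = ≤-trans bound (≤-trans (≤-reflexive (+-suc (potential a) fuel))
                                  (+-monoˡ-≤ fuel (Step-potential (successors-sound a s∈))))
    viaSuccessor : Any (λ s → Star Step s b) (successors a) → Star Step a b
    viaSuccessor p with _ , s∈ , s→b ← find p = successors-sound a s∈ ◅ s→b
    firstStep : Star Step a b → Any (λ s → Star Step s b) (successors a)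
    firstStep ε       = ⊥-elim (a≢b refl)
    firstStep (s ◅ p) = lose (successors-complete s) p

  Any-Star? : ∀ fuel b ss → All (λ s → potential b ≤ potential s + fuel) ss →
              Dec (Any (λ s → Star Step s b) ss)
  Any-Star? fuel b []       []       = no λ ()
  Any-Star? fuel b (s ∷ ss) (h ∷ hs) =
    map′ Any.fromSum Any.toSum (Star? fuel s b h ⊎-dec Any-Star? fuel b ss hs)

_≤T?_ : ∀ a b → Dec (a ≤T b)
a ≤T? b = map′ Star⇒≤T ≤T⇒Star (Star? (potential b) a b (m≤n+m _ _))

deg-/ : ∀ x y → deg (x /ᵗ y) ≡ deg x + deg y
deg-/ x leaf    = sym (+-identityʳ (deg x))
deg-/ x (c ∨ d) = begin
  suc (deg (x /ᵗ c) + deg d)   ≡⟨ cong (λ n → suc (n + deg d)) (deg-/ x c) ⟩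
  suc (deg x + deg c + deg d)  ≡⟨ cong suc (+-assoc (deg x) (deg c) (deg d)) ⟩
  suc (deg x + (deg c + deg d)) ≡⟨ sym (+-suc (deg x) (deg c + deg d)) ⟩
  deg x + deg (c ∨ d)          ∎
  where open ≡-Reasoning

deg-∖ : ∀ x y → deg (x ∖ᵗ y) ≡ deg x + deg y
deg-∖ leaf    y = refl
deg-∖ (a ∨ b) y = cong suc (trans (cong (deg a +_) (deg-∖ b y)) (sym (+-assoc (deg a) (deg b) (deg y))))

deg</∨ : ∀ x c d → deg x < deg (x /ᵗ (c ∨ d))
deg</∨ x c d = <-≤-trans (m<m+n (deg x) z<s) (≤-reflexive (sym (deg-/ x (c ∨ d))))

deg<∖∨ : ∀ x c d → deg x < deg (x ∖ᵗ (c ∨ d))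
deg<∖∨ x c d = <-≤-trans (m<m+n (deg x) z<s) (≤-reflexive (sym (deg-∖ x (c ∨ d))))

/-identityˡ : ∀ y → leaf /ᵗ y ≡ y
/-identityˡ leaf    = refl
/-identityˡ (c ∨ d) = cong (_∨ d) (/-identityˡ c)

∖-identityʳ : ∀ x → x ∖ᵗ leaf ≡ x
∖-identityʳ leaf    = refl
∖-identityʳ (a ∨ b) = cong (a ∨_) (∖-identityʳ b)

∖-∨-≤T : ∀ x c d → ((x ∖ᵗ c) ∨ d) ≤T (x ∖ᵗ (c ∨ d))
∖-∨-≤T leaf    c d = ≤T-refl (c ∨ d)
∖-∨-≤T (a ∨ b) c d = ≤T-trans (rot a (b ∖ᵗ c) d) (graftʳ a (∖-∨-≤T b c d))

/≤T∖ : ∀ x y → (x /ᵗ y) ≤T (x ∖ᵗ y)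
/≤T∖ x leaf    = subst (x ≤T_) (sym (∖-identityʳ x)) (≤T-refl x)
/≤T∖ x (c ∨ d) = ≤T-trans (graftˡ d (/≤T∖ x c)) (∖-∨-≤T x c d)

/-cancel : ∀ {r r′} b b′ → deg r ≡ deg r′ → r /ᵗ b ≡ r′ /ᵗ b′ → r ≡ r′ × b ≡ b′
/-cancel leaf leaf _ e = e , refl
/-cancel {r′ = r′} leaf (c ∨ d) dr e =
  ⊥-elim (<-irrefl (trans (sym dr) (cong deg e)) (deg</∨ r′ c d))
/-cancel {r = r} (c ∨ d) leaf dr e =
  ⊥-elim (<-irrefl (trans dr (cong deg (sym e))) (deg</∨ r c d))
/-cancel (c ∨ d) (c′ ∨ d′) dr e with ∨-injective e
... | e₁ , refl with /-cancel c c′ dr e₁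
...   | refl , refl = refl , refl

-- The left subtree of r′ /ᵗ (c′ ∨ d′) has degree at least deg r′; that of (e ∨ f) ∖ᵗ (c ∨ d)
-- is e, of degree below deg (e ∨ f).
∖≢/ : ∀ e f c d {r′} b′ → deg (e ∨ f) ≡ deg r′ → (e ∨ f) ∖ᵗ (c ∨ d) ≢ r′ /ᵗ b′
∖≢/ e f c d leaf dr eq = <-irrefl (trans dr (cong deg (sym eq))) (deg<∖∨ (e ∨ f) c d)
∖≢/ e f c d {r′} (c′ ∨ d′) dr eq = <⇒≱ (s≤s (m≤m+n (deg e) (deg f))) (begin
  deg (e ∨ f)        ≡⟨ dr ⟩
  deg r′             ≤⟨ m≤m+n (deg r′) (deg c′) ⟩
  deg r′ + deg c′    ≡⟨ sym (deg-/ r′ c′) ⟩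
  deg (r′ /ᵗ c′)     ≡⟨ cong deg (sym (proj₁ (∨-injective eq))) ⟩
  deg e              ∎)
  where open ≤-Reasoning

-- Counting with duplicate-free lists

module _ {A : Set} where

  ∈-─⁺ : ∀ {x y} {xs : List A} (x∈ : x ∈ xs) → y ∈ xs → y ≢ x → y ∈ (xs ─ x∈)
  ∈-─⁺ (here refl) (here refl) y≢x = ⊥-elim (y≢x refl)
  ∈-─⁺ (here refl) (there y∈)  _   = y∈
  ∈-─⁺ (there x∈)  (here refl) _   = here refl
  ∈-─⁺ (there x∈)  (there y∈)  y≢x = there (∈-─⁺ x∈ y∈ y≢x)

  Unique-⊆⇒length≤ : ∀ {xs ys : List A} → Unique xs → xs ⊆ ys → length xs ≤ length ys
  Unique-⊆⇒length≤ {[]}     _            _   = z≤n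
  Unique-⊆⇒length≤ {x ∷ xs} {ys} (x∉xs ∷ u) xs⊆ys = begin
    suc (length xs)               ≤⟨ s≤s (Unique-⊆⇒length≤ u xs⊆ys─x) ⟩
    suc (length (ys ─ x∈ys))      ≡⟨ sym (length-removeAt′ ys (Any.index x∈ys)) ⟩
    length ys                     ∎
    where
    open ≤-Reasoning
    x∈ys = xs⊆ys (here refl)
    xs⊆ys─x : xs ⊆ (ys ─ x∈ys)
    xs⊆ys─x t∈ = ∈-─⁺ x∈ys (xs⊆ys (there t∈)) (λ t≡x → All.lookup x∉xs t∈ (sym t≡x))

  Unique-⊆-length≥⇒⊇ : DecidableEquality A → ∀ {xs ys : List A} →
                       Unique xs → xs ⊆ ys → length ys ≤ length xs → ys ⊆ xs
  Unique-⊆-length≥⇒⊇ _≟ᴬ_ {xs} {ys} u xs⊆ys ys≤xs {t} t∈ys with t ∈? xs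
    where open import Data.List.Membership.DecPropositional _≟ᴬ_ using (_∈?_)
  ... | yes t∈xs = t∈xs
  ... | no  t∉xs = ⊥-elim (<⇒≱ (Unique-⊆⇒length≤ (t∉ ∷ u) t∷xs⊆ys) ys≤xs)
    where
    t∉ : All (t ≢_) xs
    t∉ = All.tabulate λ t′∈ t≡t′ → t∉xs (subst (_∈ xs) (sym t≡t′) t′∈)
    t∷xs⊆ys : (t ∷ xs) ⊆ ys
    t∷xs⊆ys (here refl) = t∈ys
    t∷xs⊆ys (there t′∈) = xs⊆ys t′∈

  Unique-map⁺-injectiveOn : ∀ {B : Set} (f : A → B) {xs : List A} → Unique xs →
                            (∀ {a a′} → a ∈ xs → a′ ∈ xs → f a ≡ f a′ → a ≡ a′) → Unique (map f xs)
  Unique-map⁺-injectiveOn f {[]}     []         _   = []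
  Unique-map⁺-injectiveOn f {x ∷ xs} (x∉xs ∷ u) inj =
    All.map⁺ (All.tabulate λ a∈ fx≡fa → All.lookup x∉xs a∈ (inj (here refl) (there a∈) fx≡fa))
    ∷ Unique-map⁺-injectiveOn f u (λ a∈ a′∈ → inj (there a∈) (there a′∈))

length-cartesianProduct : ∀ {A B : Set} (xs : List A) (ys : List B) →
                          length (cartesianProduct xs ys) ≡ length xs * length ys
length-cartesianProduct []       ys = refl
length-cartesianProduct (x ∷ xs) ys =
  trans (length-++ (map (x ,_) ys)) (cong₂ _+_ (length-map (x ,_) ys) (length-cartesianProduct xs ys))

module _ {P : Tree → Set} {k : ℕ} where

  HasCount-≥ : HasCount P k → ∀ {ms} → Unique ms → (∀ {t} → t ∈ ms → P t) → length ms ≤ k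
  HasCount-≥ (ls , _ , ls⇔P , refl) ms-unique ms⊆P =
    Unique-⊆⇒length≤ ms-unique (λ {t} t∈ → from (ls⇔P t) (ms⊆P t∈))

  HasCount-≡⇒⊆ : HasCount P k → ∀ {ms} → Unique ms → (∀ {t} → t ∈ ms → P t) →
                 k ≡ length ms → ∀ {t} → P t → t ∈ ms
  HasCount-≡⇒⊆ (ls , _ , ls⇔P , refl) ms-unique ms⊆P k≡ms {t} Pt =
    Unique-⊆-length≥⇒⊇ _≟_ ms-unique (λ {t} t∈ → from (ls⇔P t) (ms⊆P t∈))
                       (≤-reflexive k≡ms) (from (ls⇔P t) Pt)

  HasCount-⊆⇒≡ : HasCount P k → ∀ {ms} → Unique ms → (∀ {t} → t ∈ ms → P t) →
                 (∀ {t} → P t → t ∈ ms) → k ≡ length ms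
  HasCount-⊆⇒≡ count@(ls , ls-unique , ls⇔P , refl) ms-unique ms⊆P P⊆ms =
    ≤-antisym (Unique-⊆⇒length≤ ls-unique (λ {t} t∈ → P⊆ms (to (ls⇔P t) t∈)))
              (HasCount-≥ count ms-unique ms⊆P)

HasCount-cong : ∀ {P Q : Tree → Set} {k} → (∀ t → P t ⇔ Q t) → HasCount P k → HasCount Q k
HasCount-cong P⇔Q (ls , ls-unique , ls⇔P , ls-length) =
  ls , ls-unique , (λ t → ⇔.trans (ls⇔P t) (P⇔Q t)) , ls-length

treesOfDegree≤ : ℕ → List Tree
treesOfDegree≤ zero    = leaf ∷ []
treesOfDegree≤ (suc n) = leaf ∷ cartesianProductWith _∨_ (treesOfDegree≤ n) (treesOfDegree≤ n)

treesOfDegree≤-unique : ∀ n → Unique (treesOfDegree≤ n)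
treesOfDegree≤-unique zero    = [] ∷ []
treesOfDegree≤-unique (suc n) =
  All.tabulate leaf∉ ∷ Unique.cartesianProductWith⁺ _∨_ ∨-injective (treesOfDegree≤-unique n) (treesOfDegree≤-unique n)
  where
  leaf∉ : ∀ {t} → t ∈ cartesianProductWith _∨_ (treesOfDegree≤ n) (treesOfDegree≤ n) → leaf ≢ t
  leaf∉ t∈ refl with _ , _ , _ , _ , () ← ∈-cartesianProductWith⁻ _∨_ (treesOfDegree≤ n) (treesOfDegree≤ n) t∈

treesOfDegree≤-complete : ∀ n t → deg t ≤ n → t ∈ treesOfDegree≤ n
treesOfDegree≤-complete zero    leaf    _         = here refl
treesOfDegree≤-complete (suc n) leaf    _         = here refl
treesOfDegree≤-complete (suc n) (l ∨ r) (s≤s l+r≤n) = there (∈-cartesianProductWith⁺ _∨_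
  (treesOfDegree≤-complete n l (≤-trans (m≤m+n (deg l) (deg r)) l+r≤n))
  (treesOfDegree≤-complete n r (≤-trans (m≤n+m (deg r) (deg l)) l+r≤n)))

HasCount-decidable : ∀ {P : Tree → Set} n → Decidable P → (∀ {t} → P t → deg t ≤ n) → ∃ (HasCount P)
HasCount-decidable n P? P⇒deg≤n =
  _ , filter P? (treesOfDegree≤ n) , Unique.filter⁺ P? (treesOfDegree≤-unique n) ,
  (λ t → mk⇔ (proj₂ ∘ ∈-filter⁻ P? {xs = treesOfDegree≤ n})
             (λ Pt → ∈-filter⁺ P? {xs = treesOfDegree≤ n} (treesOfDegree≤-complete n t (P⇒deg≤n Pt)) Pt)) ,
  refl

-- Left sums

_∈+?_ : ∀ z xy → Dec (z ∈+ xy)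
z ∈+? (x , y) = ((x /ᵗ y) ≤T? z) ×-dec (z ≤T? (x ∖ᵗ y))

_∈⊣?_ : ∀ z ab → Dec (z ∈⊣ ab)
z         ∈⊣? (leaf , b)  = z ≟ leaf
leaf      ∈⊣? (l ∨ r , b) = no λ { (_ , () , _) }
(l′ ∨ w)  ∈⊣? (l ∨ r , b) = map′ (λ { (refl , w∈) → w , refl , w∈ }) (λ { (_ , refl , w∈) → refl , w∈ })
                                 ((l′ ≟ l) ×-dec (w ∈+? (r , b)))

∈⊣-deg : ∀ {z} a b → z ∈⊣ (a , b) → deg z ≤ deg a + deg b
∈⊣-deg leaf    b refl = z≤n
∈⊣-deg (l ∨ r) b (w , refl , r/b≤w , _) = ≤-reflexive (cong suc (begin
  deg l + deg w             ≡⟨ cong (deg l +_) (trans (sym (≤T-deg r/b≤w)) (deg-/ r b)) ⟩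
  deg l + (deg r + deg b)   ≡⟨ sym (+-assoc (deg l) (deg r) (deg b)) ⟩
  deg l + deg r + deg b     ∎))
  where open ≡-Reasoning

∈-deg : ∀ {n} (g : Grove n) {t} → t ∈ trees g → deg t ≡ n
∈-deg g = All.lookup (degrees g)

∈-nonempty : ∀ {A : Set} {xs : List A} → ¬ xs ≡ [] → ∃ (_∈ xs)
∈-nonempty {xs = []}    xs≢[] = ⊥-elim (xs≢[] refl)
∈-nonempty {xs = x ∷ _} _     = x , here refl

⊣-bottom : Tree → Tree → Tree
⊣-bottom leaf    b = leaf
⊣-bottom (l ∨ r) b = l ∨ (r /ᵗ b)

⊣-bottom-∈⊣ : ∀ a b → ⊣-bottom a b ∈⊣ (a , b)
⊣-bottom-∈⊣ leaf    b = refl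
⊣-bottom-∈⊣ (l ∨ r) b = r /ᵗ b , refl , ≤T-refl (r /ᵗ b) , /≤T∖ r b

⊣-top-∈⊣ : ∀ l r b → (l ∨ (r ∖ᵗ b)) ∈⊣ (l ∨ r , b)
⊣-top-∈⊣ l r b = r ∖ᵗ b , refl , /≤T∖ r b , ≤T-refl (r ∖ᵗ b)

⊣-bottom-injective : ∀ {a a′} b b′ → 0 < deg a → deg a ≡ deg a′ →
                     ⊣-bottom a b ≡ ⊣-bottom a′ b′ → a ≡ a′ × b ≡ b′
⊣-bottom-injective {l ∨ r} {l′ ∨ r′} b b′ _ da eq with ∨-injective eq
... | refl , r/b≡r′/b′ with /-cancel b b′ (deg-∨-cancelˡ da) r/b≡r′/b′
...   | refl , refl = refl , refl

⊣-top≢bottom : ∀ {l r a′} b b′ → r ≢ leaf → 0 < deg b → deg (l ∨ r) ≡ deg a′ →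
               l ∨ (r ∖ᵗ b) ≢ ⊣-bottom a′ b′
⊣-top≢bottom {r = leaf} _ _ r≢leaf _ _ _ = r≢leaf refl
⊣-top≢bottom {l} {e ∨ f} {l′ ∨ r′} (c ∨ d) b′ _ _ da eq with ∨-injective eq
... | refl , r∖b≡r′/b′ = ∖≢/ e f c d b′ (deg-∨-cancelˡ {l} {e ∨ f} {r′} da) r∖b≡r′/b′

-- When r = leaf the interval leaf / b ≤ w ≤ leaf ∖ b collapses to the single tree b.
∈⊣-leftInherited : ∀ {z a} b → LeftInherited a → z ∈⊣ (a , b) → z ≡ ⊣-bottom a b
∈⊣-leftInherited {a = l ∨ leaf} b refl (w , refl , b≤w , w≤b) =
  cong (l ∨_) (trans (≤T-antisym w≤b (subst (_≤T w) (/-identityˡ b) b≤w)) (sym (/-identityˡ b)))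

module _ {p q} (x : Grove p) (y : Grove q) where

  LeftSum-deg : ∀ {z} → LeftSum x y z → deg z ≤ p + q
  LeftSum-deg {z} z∈ with a , a∈ , z∈a⊣y ← find z∈ with b , b∈ , z∈a⊣b ← find z∈a⊣y =
    subst (deg z ≤_) (cong₂ _+_ (∈-deg x a∈) (∈-deg y b∈)) (∈⊣-deg a b z∈a⊣b)

  LeftSum-hasCount : ∃ (HasCount (LeftSum x y))
  LeftSum-hasCount = HasCount-decidable (p + q)
    (λ z → any? (λ a → any? (λ b → z ∈⊣? (a , b)) (trees y)) (trees x)) LeftSum-deg

  bottoms : List Tree
  bottoms = map (uncurry ⊣-bottom) (cartesianProduct (trees x) (trees y))

  length-bottoms : length bottoms ≡ C x * C y
  length-bottoms = trans (length-map (uncurry ⊣-bottom) (cartesianProduct (trees x) (trees y)))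
                         (length-cartesianProduct (trees x) (trees y))

  ⊣-bottom-∈-bottoms : ∀ {a b} → a ∈ trees x → b ∈ trees y → ⊣-bottom a b ∈ bottoms
  ⊣-bottom-∈-bottoms a∈ b∈ = ∈-map⁺ (uncurry ⊣-bottom) (∈-cartesianProduct⁺ a∈ b∈)

  ∈-bottoms⁻ : ∀ {t} → t ∈ bottoms → ∃₂ λ a b → a ∈ trees x × b ∈ trees y × t ≡ ⊣-bottom a b
  ∈-bottoms⁻ t∈ with (a , b) , ab∈ , t≡ ← ∈-map⁻ (uncurry ⊣-bottom) t∈
                with a∈ , b∈ ← ∈-cartesianProduct⁻ (trees x) (trees y) ab∈ = a , b , a∈ , b∈ , t≡

  bottoms-unique : 1 ≤ p → Unique bottoms
  bottoms-unique hp = Unique-map⁺-injectiveOn (uncurry ⊣-bottom)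
    (Unique.cartesianProduct⁺ (distinct x) (distinct y)) injective
    where
    injective : ∀ {u v} → u ∈ cartesianProduct (trees x) (trees y) → v ∈ cartesianProduct (trees x) (trees y) →
                uncurry ⊣-bottom u ≡ uncurry ⊣-bottom v → u ≡ v
    injective {a , b} {a′ , b′} u∈ v∈ eq
      with a∈ , _ ← ∈-cartesianProduct⁻ (trees x) (trees y) u∈
      with a′∈ , _ ← ∈-cartesianProduct⁻ (trees x) (trees y) v∈ =
      uncurry (cong₂ _,_) (⊣-bottom-injective b b′ (subst (1 ≤_) (sym (∈-deg x a∈)) hp)
                                              (trans (∈-deg x a∈) (sym (∈-deg x a′∈))) eq)

  bottoms⊆LeftSum : ∀ {t} → t ∈ bottoms → LeftSum x y t
  bottoms⊆LeftSum t∈ with a , b , a∈ , b∈ , refl ← ∈-bottoms⁻ t∈ = lose a∈ (lose b∈ (⊣-bottom-∈⊣ a b))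

  LeftSum⊆bottoms : LeftInheritedGrove x → ∀ {t} → LeftSum x y t → t ∈ bottoms
  LeftSum⊆bottoms inherited {t} t∈ with a , a∈ , t∈a⊣y ← find t∈ with b , b∈ , t∈a⊣b ← find t∈a⊣y =
    subst (_∈ bottoms) (sym (∈⊣-leftInherited b (All.lookup inherited a∈) t∈a⊣b)) (⊣-bottom-∈-bottoms a∈ b∈)

  -- A tree l ∨ r of x with r ≠ leaf contributes its top l ∨ (r ∖ b), which is no bottom.
  LeftSum⊆bottoms⇒leftInherited : 1 ≤ p → 1 ≤ q → (∀ {t} → LeftSum x y t → t ∈ bottoms) → LeftInheritedGrove x
  LeftSum⊆bottoms⇒leftInherited hp hq LeftSum⊆ = All.tabulate λ {a} a∈ → inherited a (∈-deg x a∈) a∈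
    where
    b = proj₁ (∈-nonempty (nonempty y))
    b∈ = proj₂ (∈-nonempty (nonempty y))
    inherited : ∀ a → deg a ≡ p → a ∈ trees x → LeftInherited a
    inherited leaf refl _ = ⊥-elim (<-irrefl refl hp)
    inherited (l ∨ r) da a∈ with r ≟ leaf
    ... | yes r≡leaf = r≡leaf
    ... | no  r≢leaf with a′ , b′ , a′∈ , _ , eq ← ∈-bottoms⁻ (LeftSum⊆ (lose a∈ (lose b∈ (⊣-top-∈⊣ l r b)))) =
      ⊥-elim (⊣-top≢bottom b b′ r≢leaf (subst (1 ≤_) (sym (∈-deg y b∈)) hq) (trans da (sym (∈-deg x a′∈))) eq)

leftSum-count : ∀ {p q} → 1 ≤ p → 1 ≤ q → (x : Grove p) → (y : Grove q) →
  Σ ℕ λ k → HasCount (LeftSum x y) k × (k ≥ C x * C y) × ((k ≡ C x * C y) ⇔ LeftInheritedGrove x)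
leftSum-count hp hq x y = k , count , lower , mk⇔ tight⇒inherited inherited⇒tight
  where
  k = proj₁ (LeftSum-hasCount x y)
  count = proj₂ (LeftSum-hasCount x y)
  unique = bottoms-unique x y hp
  lower : k ≥ C x * C y
  lower = subst (_≤ k) (length-bottoms x y) (HasCount-≥ count unique (bottoms⊆LeftSum x y))
  tight⇒inherited : k ≡ C x * C y → LeftInheritedGrove x
  tight⇒inherited k≡ = LeftSum⊆bottoms⇒leftInherited x y hp hq
    (HasCount-≡⇒⊆ count unique (bottoms⊆LeftSum x y) (trans k≡ (sym (length-bottoms x y))))
  inherited⇒tight : LeftInheritedGrove x → k ≡ C x * C y
  inherited⇒tight inherited = trans (HasCount-⊆⇒≡ count unique (bottoms⊆LeftSum x y)
                                                    (LeftSum⊆bottoms x y inherited))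
                                    (length-bottoms x y)

-- Right sums, by left–right symmetry

mirror : Tree → Tree
mirror leaf    = leaf
mirror (a ∨ b) = mirror b ∨ mirror a

mirror-involutive : ∀ t → mirror (mirror t) ≡ t
mirror-involutive leaf    = refl
mirror-involutive (a ∨ b) = cong₂ _∨_ (mirror-involutive a) (mirror-involutive b)

mirror-injective : ∀ {s t} → mirror s ≡ mirror t → s ≡ t
mirror-injective {s} {t} eq =
  trans (sym (mirror-involutive s)) (trans (cong mirror eq) (mirror-involutive t))

deg-mirror : ∀ t → deg (mirror t) ≡ deg t
deg-mirror leaf    = refl
deg-mirror (a ∨ b) = cong suc (trans (cong₂ _+_ (deg-mirror b) (deg-mirror a)) (+-comm (deg b) (deg a)))

mirror-/ : ∀ x y → mirror (x /ᵗ y) ≡ mirror y ∖ᵗ mirror x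
mirror-/ x leaf    = refl
mirror-/ x (c ∨ d) = cong (mirror d ∨_) (mirror-/ x c)

mirror-∖ : ∀ x y → mirror (x ∖ᵗ y) ≡ mirror y /ᵗ mirror x
mirror-∖ leaf    y = refl
mirror-∖ (a ∨ b) y = cong (_∨ mirror a) (mirror-∖ b y)

mirror-antitone : ∀ {a b} → a ≤T b → mirror b ≤T mirror a
mirror-antitone (rot a b c)    = rot (mirror c) (mirror b) (mirror a)
mirror-antitone (graftˡ c p)   = graftʳ (mirror c) (mirror-antitone p)
mirror-antitone (graftʳ c p)   = graftˡ (mirror c) (mirror-antitone p)
mirror-antitone (≤T-refl a)    = ≤T-refl (mirror a)
mirror-antitone (≤T-trans p q) = ≤T-trans (mirror-antitone q) (mirror-antitone p)

mirror-∈+ : ∀ {z x y} → z ∈+ (x , y) → mirror z ∈+ (mirror y , mirror x)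
mirror-∈+ {z} {x} {y} (x/y≤z , z≤x∖y) =
  subst (_≤T mirror z) (mirror-∖ x y) (mirror-antitone z≤x∖y) ,
  subst (mirror z ≤T_) (mirror-/ x y) (mirror-antitone x/y≤z)

mirror-∈⊢ : ∀ {z} a b → z ∈⊢ (a , b) → mirror z ∈⊣ (mirror b , mirror a)
mirror-∈⊢ a leaf    z≡leaf              = cong mirror z≡leaf
mirror-∈⊢ a (l ∨ r) (w , refl , w∈a+l) = mirror w , refl , mirror-∈+ {w} {a} {l} w∈a+l

mirror-∈⊣ : ∀ {z} a b → z ∈⊣ (a , b) → mirror z ∈⊢ (mirror b , mirror a)
mirror-∈⊣ leaf    b z≡leaf              = cong mirror z≡leaf
mirror-∈⊣ (l ∨ r) b (w , refl , w∈r+b) = mirror w , refl , mirror-∈+ {w} {r} {b} w∈r+b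

∈⊢⇔mirror-∈⊣ : ∀ z a b → z ∈⊢ (a , b) ⇔ mirror z ∈⊣ (mirror b , mirror a)
∈⊢⇔mirror-∈⊣ z a b = mk⇔ (mirror-∈⊢ a b) λ h →
  subst₂ (λ z′ ab → z′ ∈⊢ ab) (mirror-involutive z)
         (cong₂ _,_ (mirror-involutive a) (mirror-involutive b))
         (mirror-∈⊣ (mirror b) (mirror a) h)

mirrorGrove : ∀ {n} → Grove n → Grove n
mirrorGrove g = record
  { trees    = map mirror (trees g)
  ; distinct = Unique.map⁺ mirror-injective (distinct g)
  ; nonempty = nonempty g ∘ map-≡-[] (trees g)
  ; degrees  = All.map⁺ (All.map (trans (deg-mirror _)) (degrees g))
  }
  where
  map-≡-[] : ∀ xs → map mirror xs ≡ [] → xs ≡ []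
  map-≡-[] [] _ = refl

C-mirrorGrove : ∀ {n} (g : Grove n) → C (mirrorGrove g) ≡ C g
C-mirrorGrove g = length-map mirror (trees g)

RightSum⇔LeftSum-mirror : ∀ {p q} (x : Grove p) (y : Grove q) z →
                          RightSum x y z ⇔ LeftSum (mirrorGrove y) (mirrorGrove x) (mirror z)
RightSum⇔LeftSum-mirror x y z = mk⇔
  (Any.map⁺ ∘ Any.map (Any.map⁺) ∘ Any.swap ∘ Any.map (Any.map (to (∈⊢⇔mirror-∈⊣ z _ _))))
  (Any.map (Any.map (from (∈⊢⇔mirror-∈⊣ z _ _))) ∘ Any.swap ∘ Any.map (Any.map⁻) ∘ Any.map⁻)

mirror-leftInherited : ∀ t → LeftInherited (mirror t) ⇔ RightInherited t
mirror-leftInherited leaf    = mk⇔ id id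
mirror-leftInherited (l ∨ r) = mk⇔ mirror-injective (cong mirror)

mirrorGrove-leftInherited : ∀ {n} (g : Grove n) → LeftInheritedGrove (mirrorGrove g) ⇔ RightInheritedGrove g
mirrorGrove-leftInherited g = mk⇔
  (All.map (to (mirror-leftInherited _)) ∘ All.map⁻)
  (All.map⁺ ∘ All.map (from (mirror-leftInherited _)))

HasCount-mirror : ∀ {P k} → HasCount P k → HasCount (P ∘ mirror) k
HasCount-mirror {P} (ls , ls-unique , ls⇔P , ls-length) =
  map mirror ls , Unique.map⁺ mirror-injective ls-unique ,
  (λ t → mk⇔ (∈⇒P t) (P⇒∈ t)) , trans (length-map mirror ls) ls-length
  where
  ∈⇒P : ∀ t → t ∈ map mirror ls → P (mirror t)
  ∈⇒P t t∈ with s , s∈ , refl ← ∈-map⁻ mirror t∈ =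
    subst P (sym (mirror-involutive s)) (to (ls⇔P s) s∈)
  P⇒∈ : ∀ t → P (mirror t) → t ∈ map mirror ls
  P⇒∈ t Pt = subst (_∈ map mirror ls) (mirror-involutive t) (∈-map⁺ mirror (from (ls⇔P (mirror t)) Pt))

rightSum-count : ∀ {p q} → 1 ≤ p → 1 ≤ q → (x : Grove p) → (y : Grove q) →
  Σ ℕ λ k → HasCount (RightSum x y) k × (k ≥ C x * C y) × ((k ≡ C x * C y) ⇔ RightInheritedGrove y)
rightSum-count hp hq x y with k , count , lower , tight ← leftSum-count hq hp (mirrorGrove y) (mirrorGrove x) =
  k ,
  HasCount-cong (λ z → ⇔.sym (RightSum⇔LeftSum-mirror x y z)) (HasCount-mirror count) ,
  subst (_≤ k) C-swap lower ,
  ⇔.trans (mk⇔ (λ k≡ → trans k≡ (sym C-swap)) (λ k≡ → trans k≡ C-swap))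
          (⇔.trans tight (mirrorGrove-leftInherited y))
  where
  C-swap : C (mirrorGrove y) * C (mirrorGrove x) ≡ C x * C y
  C-swap = trans (cong₂ _*_ (C-mirrorGrove y) (C-mirrorGrove x)) (*-comm (C y) (C x))

mainTheorem1 : ∀ {p q} → 1 ≤ p → 1 ≤ q → (x : Grove p) → (y : Grove q) →
    (Σ ℕ λ k → HasCount (LeftSum x y) k × (k ≥ C x * C y) × ((k ≡ C x * C y) ⇔ LeftInheritedGrove x))
    × (Σ ℕ λ k → HasCount (RightSum x y) k × (k ≥ C x * C y) × ((k ≡ C x * C y) ⇔ RightInheritedGrove y))
mainTheorem1 hp hq x y = leftSum-count hp hq x y , rightSum-count hp hq x y
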